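{- Let $G$ be a rooted directed path graph and $(T,\{P_v: v\in V(G)\})$ a minimal tree model of $G$. Then for every node $p\in V(T)$ that is not the root of $T$: (i) there is $u\in V(G)$ such that $p=\mathsf{high}(u)$; and (ii) there is $w\in V(G)$ such that $V(P_w)$ contains the parent $p'$ of $p$ but does not contain $p$.
   Context: A tree model of a rooted directed path graph $G$ consists of a directed tree $T$ with a root from which every node is reachable, and for each $v\in V(G)$ a directed path $P_v$ in $T$, such that $uw\in E(G)$ iff $V(P_u)\cap V(P_w)\neq\emptyset$. For a node $p$, let $V_p=\{u\in V(G): p\in V(P_u)\}$. The model is minimal if there are no two adjacent nodes $p,p'$ of $T$ with $V_p\subseteq V_{p'}$. For $v\in V(G)$, $\mathsf{high}(v)$ is the node of $P_v$ closest to the root of $T$. -}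

module Defs where

open import Data.Nat using (ℕ)
open import Data.Unit using (⊤)
open import Data.Fin using (Fin)
open import Data.List using (List; []; _∷_)
open import Data.List.Membership.Propositional using (_∈_)
open import Data.Product using (Σ; ∃; _×_)
open import Function using (_∘_)
open import Function.Bundles using (_⇔_)
open import Relation.Nullary using (¬_)
open import Relation.Binary.PropositionalEquality using (_≡_; _≢_)

iter : {A : Set} → (A → A) → ℕ → A → A
iter f ℕ.zero x = x
iter f (ℕ.suc k) x = f (iter f k x)

-- Every non-root node p has exactly one incoming arc  parent p → p;
-- the root is the unique node without parent (encoded as parent root ≡ root),
-- and every node is reachable from the root (iterating parent from any node
-- reaches the root, which also rules out cycles).
record RootedTree : Set where
  field
    n           : ℕ
    root        : Fin n
    parent      : Fin n → Fin n
    parent-root : parent root ≡ root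
    reachable   : ∀ p → ∃ λ k → iter parent k p ≡ root

  Arc : Fin n → Fin n → Set
  Arc a b = b ≢ root × parent b ≡ a

  Chain : Fin n → List (Fin n) → Set
  Chain a [] = ⊤
  Chain a (b ∷ bs) = Arc a b × Chain b bs

record DPath (T : RootedTree) : Set where
  open RootedTree T
  field
    start : Fin n
    rest  : List (Fin n)
    chain : Chain start rest

  nodes : List (Fin n)
  nodes = start ∷ rest

_∈P_ : {T : RootedTree} → Fin (RootedTree.n T) → DPath T → Set
p ∈P P = p ∈ DPath.nodes P

record TreeModel (m : ℕ) (E : Fin m → Fin m → Set) : Set₁ where
  field
    T     : RootedTree
    P     : Fin m → DPath T
    model : ∀ u w → u ≢ w →
            (E u w ⇔ ∃ λ p → (p ∈P P u) × (p ∈P P w))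

  open RootedTree T public

  Vsub : Fin n → Fin n → Set
  Vsub p q = ∀ u → p ∈P P u → q ∈P P u

  -- high(v): the node of P_v closest to the root (its first node)
  high : Fin m → Fin n
  high v = DPath.start (P v)

  Minimal : Set
  Minimal = ∀ p → p ≢ root → ¬ Vsub p (parent p) × ¬ Vsub (parent p) p

record SimpleGraph (m : ℕ) (E : Fin m → Fin m → Set) : Set where
  field
    irrefl : ∀ u → ¬ E u u
    sym    : ∀ u w → E u w → E w u

-- A node p ≠ root with V_p ⊈ V_{p'} lies on some P_u that misses the
-- parent p'; a directed path through p avoiding p' must start at p, so
-- p = high(u).  Likewise V_{p'} ⊈ V_p directly gives w with p' ∈ P_w ∌ p.

module Submission where

open import Defs
open import Data.Nat using (ℕ)
open import Data.Fin using (Fin)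
open import Data.Fin.Properties using (¬∀⟶∃¬) renaming (_≟_ to _≟F_)
open import Data.Product using (∃; _×_; _,_; proj₁; proj₂)
open import Data.List using (_∷_)
open import Data.List.Relation.Unary.Any using (here; there)
open import Data.List.Membership.Propositional using (_∈_)
import Data.List.Membership.DecPropositional as DecMembership
open import Data.Empty using (⊥-elim)
open import Relation.Nullary using (¬_; Dec; yes; no)
open import Relation.Nullary.Decidable using (_→-dec_)
open import Relation.Binary.PropositionalEquality using (_≡_; _≢_; refl)

¬⇒⇒∃×¬ : ∀ {a b} {m : ℕ} {A : Fin m → Set a} {B : Fin m → Set b} →
         (∀ u → Dec (A u)) → (∀ u → Dec (B u)) →
         ¬ (∀ u → A u → B u) → ∃ λ u → A u × ¬ B u
¬⇒⇒∃×¬ {m = m} A? B? ¬A⇒B with ¬∀⟶∃¬ m _ (λ u → A? u →-dec B? u) ¬A⇒B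
... | u , ¬Au⇒Bu with A? u
...   | yes Au = u , Au , λ Bu → ¬Au⇒Bu (λ _ → Bu)
...   | no ¬Au = ⊥-elim (¬Au⇒Bu (λ Au → ⊥-elim (¬Au Au)))

module _ (T : RootedTree) where
  open RootedTree T

  Chain-parent∈ : ∀ {a bs} → Chain a bs → ∀ {p} → p ∈ bs → parent p ∈ a ∷ bs
  Chain-parent∈ (arc , _)  (here refl) = here (proj₂ arc)
  Chain-parent∈ (_ , chain) (there p∈) = there (Chain-parent∈ chain p∈)

  start≡ : (D : DPath T) → ∀ {p} → p ∈P D → ¬ (parent p ∈P D) → DPath.start D ≡ p
  start≡ D (here refl) _         = refl
  start≡ D (there p∈)  parent∉D = ⊥-elim (parent∉D (Chain-parent∈ (DPath.chain D) p∈))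

module _ {m : ℕ} {E : Fin m → Fin m → Set} (M : TreeModel m E) where
  open TreeModel M
  open DecMembership (_≟F_ {n}) using (_∈?_)

  _∈P?_ : ∀ q u → Dec (q ∈P P u)
  q ∈P? u = q ∈? DPath.nodes (P u)

  ¬Vsub⇒∃∈∉ : ∀ q r → ¬ Vsub q r → ∃ λ u → (q ∈P P u) × ¬ (r ∈P P u)
  ¬Vsub⇒∃∈∉ q r = ¬⇒⇒∃×¬ (q ∈P?_) (r ∈P?_)

lemma3p4 : (m : ℕ) (E : Fin m → Fin m → Set) → SimpleGraph m E →
    (M : TreeModel m E) → TreeModel.Minimal M →
    ∀ p → p ≢ TreeModel.root M →
      (∃ λ u → TreeModel.high M u ≡ p)
      × (∃ λ w → (TreeModel.parent M p ∈P TreeModel.P M w) × ¬ (p ∈P TreeModel.P M w))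
lemma3p4 m E _ M minimal p p≢root = high≡p , ¬Vsub⇒∃∈∉ M (parent p) p Vparent⊈Vp
  where
  open TreeModel M
  Vp⊈Vparent : ¬ Vsub p (parent p)
  Vp⊈Vparent = proj₁ (minimal p p≢root)
  Vparent⊈Vp : ¬ Vsub (parent p) p
  Vparent⊈Vp = proj₂ (minimal p p≢root)

  high≡p : ∃ λ u → high u ≡ p
  high≡p with ¬Vsub⇒∃∈∉ M p (parent p) Vp⊈Vparent
  ... | u , p∈Pu , parent∉Pu = u , start≡ T (P u) p∈Pu parent∉Pu
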